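{- For every integer $n\ge 1$, the number $g(n)$ of integer sequences $(a_1,\dots,a_n)$ satisfying $0\le a_i\le n-1$ for all $1\le i\le n$ and $a_i-1\le a_{i+1}$ for all $1\le i\le n$ (where indices are taken modulo $n$, so $a_{n+1}=a_1$) is \[ g(n)=(n+2)\binom{2n-1}{n-1}-2^{2n-1}. \]
   Context: Such sequences are called circular area sequences of length $n$. -}

module Defs where

open import Data.Nat using (ℕ; zero; suc; _+_; _≤_; _≤?_; _%_)
open import Data.Nat.DivMod using (m%n<n)
open import Data.Fin using (Fin; toℕ; fromℕ<)
open import Data.List using (List; []; _∷_; map; concatMap; length; filter; allFin)
open import Relation.Nullary using (Dec)
open import Data.Fin.Properties using (all?)

-- Index i+1 taken modulo n (indices 0..n-1 stand for 1..n), so the last wraps to the first.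
next : {n : ℕ} → Fin n → Fin n
next {suc n} i = fromℕ< (m%n<n (suc (toℕ i)) (suc n))

-- A sequence (a_0,…,a_{n-1}) with 0 ≤ a_i ≤ n-1 is a function Fin n → Fin n.
-- Circular area condition: a_i - 1 ≤ a_{i+1} (cyclically), i.e. a_i ≤ a_{i+1} + 1 in ℕ.
IsCircularArea : (n : ℕ) → (Fin n → Fin n) → Set
IsCircularArea n a = (i : Fin n) → toℕ (a i) ≤ toℕ (a (next i)) + 1

isCircularArea? : (n : ℕ) → (a : Fin n → Fin n) → Dec (IsCircularArea n a)
isCircularArea? n a = all? (λ i → toℕ (a i) ≤? toℕ (a (next i)) + 1)

allFuns : (k m : ℕ) → List (Fin k → Fin m)
allFuns zero m = (λ ()) ∷ []
allFuns (suc k) m =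
  concatMap (λ x → map (λ f → λ { Fin.zero → x ; (Fin.suc j) → f j }) (allFuns k m)) (allFin m)

g : ℕ → ℕ
g n = length (filter (isCircularArea? n) (allFuns n n))

module Submission where

-- Cut a circular area sequence open at a₀ = x: what remains is a closed walk
-- x → a₁ → ⋯ → a_{n-1} → x in {0,…,n-1} whose steps a ↦ a′ satisfy a′ ≥ a - 1.
-- Coding each step as a′ - a + 1 up-steps followed by one down-step, and dropping
-- the last down-step, such walks become lattice paths with n up- and n - 1
-- down-steps from height x inside the strip [0, n]. The reflection principle counts
-- them as C(2n-1, n) minus two binomials, one for each wall; summed over x the
-- subtracted binomials are exactly the row Σⱼ C(2n-1, j) = 2^(2n-1) without its two
-- middle entries, so g(n) = n C(2n-1, n) - (2^(2n-1) - 2 C(2n-1, n)).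

open import Defs
open import Data.Nat using (ℕ; zero; suc; _+_; _*_; _∸_; _^_; _≤_; _<_; _≤?_; z≤n; s≤s; s≤s⁻¹)
open import Data.Nat.Properties
open import Data.Nat.Combinatorics using (_C_; nCk+nC[k+1]≡[n+1]C[k+1]; nCk≡nC[n∸k]; nCn≡1)
open import Data.Nat.Combinatorics.Specification using (k>n⇒nCk≡0)
open import Data.Nat.Tactic.RingSolver using (solve-∀)
open import Data.Nat.ListAction using (sum)
open import Data.Fin using (Fin; toℕ; fromℕ; inject₁) renaming (zero to fzero; suc to fsuc)
open import Data.Fin.Properties using (toℕ-injective; toℕ-fromℕ<; toℕ-fromℕ; toℕ-inject₁; toℕ<n)
open import Data.Fin.Relation.Unary.Top using (view; ‵fromℕ; ‵inject₁)
open import Data.Nat.DivMod using (_%_; m<n⇒m%n≡m; n%n≡0)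
open import Data.List using (List; []; _∷_; _++_; map; concatMap; length; filter; allFin; tabulate)
open import Data.List.Properties using (filter-++; filter-≐; length-++; map-tabulate; map-cong)
open import Data.Product using (_×_; _,_; proj₂)
open import Relation.Nullary using (Dec; yes; no; ¬_)
open import Data.Empty using (⊥-elim)
open import Relation.Nullary.Decidable using (_×-dec_)
open import Relation.Unary using (Pred; Decidable)
open import Relation.Binary.PropositionalEquality
open import Function using (_∘_; _⇔_; mk⇔; Equivalence)
open import Function.Construct.Identity using (⇔-id)
open import Function.Construct.Symmetry using (⇔-sym)
open import Function.Construct.Composition using (_⇔-∘_)
open import Level using (0ℓ)
open import Algebra.Properties.CommutativeSemigroup +-commutativeSemigroup
  using () renaming (interchange to +-interchange; x∙yz≈y∙xz to +-comm-left)

sumFrom : ℕ → ℕ → (ℕ → ℕ) → ℕ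
sumFrom s zero    F = 0
sumFrom s (suc c) F = F s + sumFrom (suc s) c F

sumFrom-cong : ∀ s c {F G : ℕ → ℕ} → (∀ {y} → s ≤ y → y < s + c → F y ≡ G y) →
               sumFrom s c F ≡ sumFrom s c G
sumFrom-cong s zero    eq = refl
sumFrom-cong s (suc c) eq =
  cong₂ _+_ (eq ≤-refl (m<m+n s (s≤s z≤n)))
            (sumFrom-cong (suc s) c (λ {y} s<y y< → eq (<⇒≤ s<y) (subst (y <_) (sym (+-suc s c)) y<)))

sumFrom-const : ∀ s c v → sumFrom s c (λ _ → v) ≡ c * v
sumFrom-const s zero    v = refl
sumFrom-const s (suc c) v = cong (v +_) (sumFrom-const (suc s) c v)

sumFrom-zero : ∀ s c {F : ℕ → ℕ} → (∀ {y} → s ≤ y → F y ≡ 0) → sumFrom s c F ≡ 0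
sumFrom-zero s c F≡0 =
  trans (sumFrom-cong s c (λ s≤y _ → F≡0 s≤y)) (trans (sumFrom-const s c 0) (*-zeroʳ c))

sumFrom-+ : ∀ s c₁ c₂ F → sumFrom s (c₁ + c₂) F ≡ sumFrom s c₁ F + sumFrom (s + c₁) c₂ F
sumFrom-+ s zero     c₂ F = cong (λ t → sumFrom t c₂ F) (sym (+-identityʳ s))
sumFrom-+ s (suc c₁) c₂ F = begin
  F s + sumFrom (suc s) (c₁ + c₂) F
    ≡⟨ cong (F s +_) (sumFrom-+ (suc s) c₁ c₂ F) ⟩
  F s + (sumFrom (suc s) c₁ F + sumFrom (suc s + c₁) c₂ F)
    ≡⟨ sym (+-assoc (F s) _ _) ⟩
  F s + sumFrom (suc s) c₁ F + sumFrom (suc s + c₁) c₂ F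
    ≡⟨ cong (λ t → F s + sumFrom (suc s) c₁ F + sumFrom t c₂ F) (sym (+-suc s c₁)) ⟩
  F s + sumFrom (suc s) c₁ F + sumFrom (s + suc c₁) c₂ F ∎
  where open ≡-Reasoning

sumFrom-shift : ∀ s t c F → sumFrom t c (λ y → F (s + y)) ≡ sumFrom (s + t) c F
sumFrom-shift s t zero    F = refl
sumFrom-shift s t (suc c) F =
  cong (F (s + t) +_) (trans (sumFrom-shift s (suc t) c F) (cong (λ u → sumFrom u c F) (+-suc s t)))

sumFrom-suc : ∀ s c F → sumFrom s (suc c) F ≡ sumFrom s c F + F (s + c)
sumFrom-suc s zero    F = trans (+-identityʳ (F s)) (cong F (sym (+-identityʳ s)))
sumFrom-suc s (suc c) F = begin
  F s + sumFrom (suc s) (suc c) F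
    ≡⟨ cong (F s +_) (sumFrom-suc (suc s) c F) ⟩
  F s + (sumFrom (suc s) c F + F (suc s + c))
    ≡⟨ sym (+-assoc (F s) _ _) ⟩
  F s + sumFrom (suc s) c F + F (suc s + c)
    ≡⟨ cong (λ t → F s + sumFrom (suc s) c F + F t) (sym (+-suc s c)) ⟩
  F s + sumFrom (suc s) c F + F (s + suc c) ∎
  where open ≡-Reasoning

sumFrom-distrib-+ : ∀ s c F G → sumFrom s c (λ y → F y + G y) ≡ sumFrom s c F + sumFrom s c G
sumFrom-distrib-+ s zero    F G = refl
sumFrom-distrib-+ s (suc c) F G =
  trans (cong (F s + G s +_) (sumFrom-distrib-+ (suc s) c F G))
        (+-interchange (F s) (G s) (sumFrom (suc s) c F) (sumFrom (suc s) c G))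

𝟙 : {A : Set} → Dec A → ℕ
𝟙 (yes _) = 1
𝟙 (no _)  = 0

𝟙-yes : {A : Set} (D : Dec A) → A → 𝟙 D ≡ 1
𝟙-yes (yes _) _ = refl
𝟙-yes (no ¬a) a = ⊥-elim (¬a a)

𝟙-no : {A : Set} (D : Dec A) → ¬ A → 𝟙 D ≡ 0
𝟙-no (yes a) ¬a = ⊥-elim (¬a a)
𝟙-no (no _)  _  = refl

count : {A : Set} {P : Pred A 0ℓ} → Decidable P → List A → ℕ
count P? xs = length (filter P? xs)

count-∷ : {A : Set} {P : Pred A 0ℓ} (P? : Decidable P) (x : A) (xs : List A) →
          count P? (x ∷ xs) ≡ 𝟙 (P? x) + count P? xs
count-∷ P? x xs with P? x
... | yes _ = refl
... | no _  = refl

module _ {A : Set} {P : Pred A 0ℓ} (P? : Decidable P) where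

  count-++ : ∀ xs ys → count P? (xs ++ ys) ≡ count P? xs + count P? ys
  count-++ xs ys = trans (cong length (filter-++ P? xs ys)) (length-++ (filter P? xs))

  count-concatMap : {B : Set} (f : B → List A) (xs : List B) →
                    count P? (concatMap f xs) ≡ sum (map (count P? ∘ f) xs)
  count-concatMap f []       = refl
  count-concatMap f (x ∷ xs) = trans (count-++ (f x) (concatMap f xs)) (cong (count P? (f x) +_) (count-concatMap f xs))

  count-map : {B : Set} (h : B → A) (xs : List B) → count P? (map h xs) ≡ count (P? ∘ h) xs
  count-map h []       = refl
  count-map h (x ∷ xs) =
    trans (count-∷ P? (h x) (map h xs)) (trans (cong (𝟙 (P? (h x)) +_) (count-map h xs)) (sym (count-∷ (P? ∘ h) x xs)))

count-⇔ : {A : Set} {P Q : Pred A 0ℓ} (P? : Decidable P) (Q? : Decidable Q) → (∀ x → P x ⇔ Q x) →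
          ∀ xs → count P? xs ≡ count Q? xs
count-⇔ P? Q? P⇔Q xs =
  cong length (filter-≐ P? Q? ((λ {x} → Equivalence.to (P⇔Q x)) , (λ {x} → Equivalence.from (P⇔Q x))) xs)

count-×-dec : {A B : Set} {Q : Pred A 0ℓ} (D : Dec B) (Q? : Decidable Q) (xs : List A) →
              count (λ x → D ×-dec Q? x) xs ≡ 𝟙 D * count Q? xs
count-×-dec (yes b) Q? xs       = trans (count-⇔ _ Q? (λ _ → mk⇔ proj₂ (b ,_)) xs) (sym (*-identityˡ _))
count-×-dec (no _)  Q? []       = refl
count-×-dec (no ¬b) Q? (_ ∷ xs) = count-×-dec (no ¬b) Q? xs

sum-tabulate : ∀ m (F : ℕ → ℕ) → sum (tabulate {n = m} (F ∘ toℕ)) ≡ sumFrom 0 m F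
sum-tabulate zero    F = refl
sum-tabulate (suc m) F = cong (F 0 +_) (trans (sum-tabulate m (F ∘ suc)) (sumFrom-shift 1 0 m F))

sum-allFin : ∀ m (F : ℕ → ℕ) → sum (map (F ∘ toℕ) (allFin m)) ≡ sumFrom 0 m F
sum-allFin m F = trans (cong sum (map-tabulate {n = m} (λ i → i) (F ∘ toℕ))) (sum-tabulate m F)

count-allFuns-suc : ∀ k m {P : Pred (Fin (suc k) → Fin m) 0ℓ} (P? : Decidable P)
                    {Q : ℕ → Pred (Fin k → Fin m) 0ℓ} (Q? : ∀ y → Decidable (Q y)) →
                    (∀ h → P h ⇔ Q (toℕ (h fzero)) (h ∘ fsuc)) →
                    count P? (allFuns (suc k) m) ≡ sumFrom 0 m (λ y → count (Q? y) (allFuns k m))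
count-allFuns-suc k m P? Q? P⇔Q =
  trans (count-concatMap P? _ (allFin m))
        (trans (cong sum (map-cong count-extensions (allFin m))) (sum-allFin m _))
  where
  -- The underscore is the extension of f by x at position 0 from the definition of allFuns.
  count-extensions : ∀ x → count P? (map _ (allFuns k m)) ≡ count (Q? (toℕ x)) (allFuns k m)
  count-extensions x = trans (count-map P? _ (allFuns k m)) (count-⇔ _ (Q? (toℕ x)) (λ f → P⇔Q _) (allFuns k m))

module Walks {R : ℕ → ℕ → Set} (R? : ∀ a b → Dec (R a b)) (m : ℕ) where

  Chain : (k : ℕ) → ℕ → (Fin k → Fin m) → ℕ → Set
  Chain zero    a f b = R a b
  Chain (suc k) a f b = R a (toℕ (f fzero)) × Chain k (toℕ (f fzero)) (f ∘ fsuc) b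

  chain? : ∀ k a b → Decidable (λ f → Chain k a f b)
  chain? zero    a b f = R? a b
  chain? (suc k) a b f = R? a (toℕ (f fzero)) ×-dec chain? k (toℕ (f fzero)) b (f ∘ fsuc)

  walks : ℕ → ℕ → ℕ → ℕ
  walks zero    a b = 𝟙 (R? a b)
  walks (suc k) a b = sumFrom 0 m (λ y → 𝟙 (R? a y) * walks k y b)

  count-chains : ∀ k a b → count (chain? k a b) (allFuns k m) ≡ walks k a b
  count-chains zero    a b = trans (count-∷ (chain? zero a b) _ []) (+-identityʳ _)
  count-chains (suc k) a b =
    trans (count-allFuns-suc k m (chain? (suc k) a b) (λ y → λ f → R? a y ×-dec chain? k y b f) (λ _ → ⇔-id _))
          (sumFrom-cong 0 m (λ {y} _ _ → trans (count-×-dec (R? a y) (chain? k y b) (allFuns k m))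
                                               (cong (𝟙 (R? a y) *_) (count-chains k y b))))

  Linked : ∀ {k} → (Fin (suc k) → Fin m) → Set
  Linked {k} h = (j : Fin k) → R (toℕ (h (inject₁ j))) (toℕ (h (fsuc j)))

  chain⇔linked : ∀ k b (h : Fin (suc k) → Fin m) →
                 Chain k (toℕ (h fzero)) (h ∘ fsuc) b ⇔ (Linked h × R (toℕ (h (fromℕ k))) b)
  chain⇔linked zero    b h = mk⇔ ((λ ()) ,_) proj₂
  chain⇔linked (suc k) b h = mk⇔ to from
    where
    open Equivalence (chain⇔linked k b (h ∘ fsuc)) renaming (to to to′; from to from′)
    to : Chain (suc k) (toℕ (h fzero)) (h ∘ fsuc) b → Linked h × R (toℕ (h (fromℕ (suc k)))) b
    to (r₀ , c) with to′ c
    ... | linked , last = (λ { fzero → r₀ ; (fsuc j) → linked j }) , last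
    from : Linked h × R (toℕ (h (fromℕ (suc k)))) b → Chain (suc k) (toℕ (h fzero)) (h ∘ fsuc) b
    from (linked , last) = linked fzero , from′ (linked ∘ fsuc , last)

open Walks (λ a b → a ≤? b + 1) using (Chain; chain?; Linked; walks; count-chains; chain⇔linked)

next-inject₁ : ∀ {k} (j : Fin k) → next {suc k} (inject₁ j) ≡ fsuc j
next-inject₁ {k} j = toℕ-injective (begin
  toℕ (next (inject₁ j))          ≡⟨ toℕ-fromℕ< _ ⟩
  suc (toℕ (inject₁ j)) % suc k   ≡⟨ m<n⇒m%n≡m (s≤s (subst (_< k) (sym (toℕ-inject₁ j)) (toℕ<n j))) ⟩
  suc (toℕ (inject₁ j))           ≡⟨ cong suc (toℕ-inject₁ j) ⟩
  suc (toℕ j)                     ∎)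
  where open ≡-Reasoning

next-fromℕ : ∀ k → next {suc k} (fromℕ k) ≡ fzero
next-fromℕ k = toℕ-injective (begin
  toℕ (next (fromℕ k))        ≡⟨ toℕ-fromℕ< _ ⟩
  suc (toℕ (fromℕ k)) % suc k ≡⟨ cong (λ i → suc i % suc k) (toℕ-fromℕ k) ⟩
  suc k % suc k               ≡⟨ n%n≡0 (suc k) ⟩
  0                           ∎)
  where open ≡-Reasoning

circular⇔linked : ∀ k (h : Fin (suc k) → Fin (suc k)) →
                  IsCircularArea (suc k) h ⇔ (Linked (suc k) h × toℕ (h (fromℕ k)) ≤ toℕ (h fzero) + 1)
circular⇔linked k h = mk⇔ to from
  where
  to : IsCircularArea (suc k) h → Linked (suc k) h × toℕ (h (fromℕ k)) ≤ toℕ (h fzero) + 1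
  to circ = (λ j → subst (λ i → toℕ (h (inject₁ j)) ≤ toℕ (h i) + 1) (next-inject₁ j) (circ (inject₁ j)))
          , subst (λ i → toℕ (h (fromℕ k)) ≤ toℕ (h i) + 1) (next-fromℕ k) (circ (fromℕ k))
  from : Linked (suc k) h × toℕ (h (fromℕ k)) ≤ toℕ (h fzero) + 1 → IsCircularArea (suc k) h
  from (linked , last) i with view i
  ... | ‵fromℕ     rewrite next-fromℕ k = last
  ... | ‵inject₁ j rewrite next-inject₁ j = linked j

circular⇔closedChain : ∀ k (h : Fin (suc k) → Fin (suc k)) →
                       IsCircularArea (suc k) h ⇔ Chain (suc k) k (toℕ (h fzero)) (h ∘ fsuc) (toℕ (h fzero))
circular⇔closedChain k h = ⇔-sym (chain⇔linked (suc k) k (toℕ (h fzero)) h) ⇔-∘ circular⇔linked k h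

g≡∑closedWalks : ∀ k → g (suc k) ≡ sumFrom 0 (suc k) (λ x → walks (suc k) k x x)
g≡∑closedWalks k =
  trans (count-allFuns-suc k (suc k) (isCircularArea? (suc k)) (λ y → chain? (suc k) k y y) (circular⇔closedChain k))
        (sumFrom-cong 0 (suc k) (λ {y} _ _ → count-chains (suc k) k y y))

up : (ℕ → ℕ → ℕ) → ℕ → ℕ → ℕ
up p x zero    = 0
up p x (suc r) = p (suc x) r

down : (ℕ → ℕ → ℕ) → ℕ → ℕ → ℕ
down p zero    r = 0
down p (suc x) r = p x (suc r)

-- paths u d x r: ±1 paths with u up- and d down-steps from height x that stay in [0, x + r].
paths : ℕ → ℕ → ℕ → ℕ → ℕ
paths zero    zero    x r = 1
paths (suc u) zero    x r = up (paths u zero) x r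
paths zero    (suc d) x r = down (paths zero d) x r
paths (suc u) (suc d) x r = down (paths (suc u) d) x r + up (paths u (suc d)) x r

paths-ups : ∀ u x r → u ≤ r → paths u zero x r ≡ 1
paths-ups zero    x r       _         = refl
paths-ups (suc u) x (suc r) (s≤s u≤r) = paths-ups u (suc x) r u≤r

paths-downs : ∀ d x r → d ≤ x → paths zero d x r ≡ 1
paths-downs zero    x       r _         = refl
paths-downs (suc d) (suc x) r (s≤s d≤x) = paths-downs d x (suc r) d≤x

pascal-step : ∀ {M p q u P₁ P₂} →
              P₁ + M C suc p + M C suc (suc q) ≡ M C suc u →
              P₂ + M C suc (suc p) + M C suc q ≡ M C u →
              P₁ + P₂ + suc M C suc (suc p) + suc M C suc (suc q) ≡ suc M C suc u
pascal-step {M} {p} {q} {u} {P₁} {P₂} first-down first-up = begin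
  P₁ + P₂ + suc M C suc (suc p) + suc M C suc (suc q)
    ≡⟨ cong₂ (λ a b → P₁ + P₂ + a + b) (sym (nCk+nC[k+1]≡[n+1]C[k+1] M (suc p)))
                                        (sym (nCk+nC[k+1]≡[n+1]C[k+1] M (suc q))) ⟩
  P₁ + P₂ + (M C suc p + M C suc (suc p)) + (M C suc q + M C suc (suc q))
    ≡⟨ regroup P₁ P₂ (M C suc p) (M C suc (suc p)) (M C suc q) (M C suc (suc q)) ⟩
  (P₁ + M C suc p + M C suc (suc q)) + (P₂ + M C suc (suc p) + M C suc q)
    ≡⟨ cong₂ _+_ first-down first-up ⟩
  M C suc u + M C u
    ≡⟨ +-comm (M C suc u) (M C u) ⟩
  M C u + M C suc u
    ≡⟨ nCk+nC[k+1]≡[n+1]C[k+1] M u ⟩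
  suc M C suc u ∎
  where
  open ≡-Reasoning
  regroup : ∀ a b c d e f → a + b + (c + d) + (e + f) ≡ (a + c + f) + (b + d + e)
  regroup = solve-∀

-- The two binomials count the paths that touch height -1, resp. x + r + 1 (reflect the part
-- before the first touch); the side conditions make it impossible to touch both walls.
reflection : ∀ u d x r → u ≤ suc (x + r) → d ≤ suc (x + r) → d ≤ x + u → u ≤ r + d →
             paths u d x r + (u + d) C suc (x + u) + (u + d) C suc (r + d) ≡ (u + d) C u
reflection u zero x r _ _ _ u≤r+0
  rewrite +-identityʳ u | +-identityʳ r
        | paths-ups u x r u≤r+0
        | k>n⇒nCk≡0 {u} {suc (x + u)} (s≤s (m≤n+m u x))
        | k>n⇒nCk≡0 {u} {suc r} (s≤s u≤r+0)
        | nCn≡1 u = refl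
reflection zero (suc d) x r _ _ d≤x+0 _
  rewrite +-identityʳ x
        | paths-downs (suc d) x r d≤x+0
        | k>n⇒nCk≡0 {suc d} {suc x} (s≤s d≤x+0)
        | k>n⇒nCk≡0 {suc d} {suc (r + suc d)} (s≤s (m≤n+m (suc d) r)) = refl
reflection (suc zero)    (suc zero)    zero zero _        _ _        _ = refl
reflection (suc (suc u)) (suc d)       zero zero (s≤s ()) _ _        _
reflection (suc zero)    (suc (suc d)) zero zero _        _ (s≤s ()) _
reflection (suc u) (suc d) zero (suc r) c₁ c₂ c₃ c₄ =
  pascal-step {M} {u} {r + suc d} {u} {0} first-down first-up
  where
  M : ℕ
  M = u + suc d
  first-down : 0 + M C suc u + M C suc (suc (r + suc d)) ≡ M C suc u
  first-down rewrite k>n⇒nCk≡0 (s≤s (+-monoˡ-≤ (suc d) (s≤s⁻¹ c₁))) = +-identityʳ (M C suc u)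
  first-up : paths u (suc d) 1 r + M C suc (suc u) + M C suc (r + suc d) ≡ M C u
  first-up = reflection u (suc d) 1 r (m≤n⇒m≤1+n (s≤s⁻¹ c₁)) c₂ c₃ (s≤s⁻¹ c₄)
reflection (suc u) (suc d) (suc x) zero c₁ c₂ c₃ c₄ =
  pascal-step {M} {x + suc u} {d} {u} {P₂ = 0} first-down first-up
  where
  M : ℕ
  M = u + suc d
  x+1≡ : x + 1 ≡ suc (x + 0)
  x+1≡ = +-suc x 0
  d≤1+x : d ≤ suc x
  d≤1+x = subst (λ w → d ≤ suc w) (+-identityʳ x) (s≤s⁻¹ c₂)
  first-down : paths (suc u) d x 1 + M C suc (x + suc u) + M C suc (suc d) ≡ M C suc u
  first-down rewrite +-suc u d =
    reflection (suc u) d x 1 (subst (λ w → suc u ≤ suc w) (sym x+1≡) c₁)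
      (m≤n⇒m≤1+n (subst (d ≤_) (sym x+1≡) (s≤s⁻¹ c₂))) (s≤s⁻¹ c₃) c₄
  M≤ : M ≤ suc (x + suc u)
  M≤ = begin
    u + suc d        ≡⟨ +-comm u (suc d) ⟩
    suc d + u        ≤⟨ +-monoˡ-≤ u (s≤s d≤1+x) ⟩
    suc (suc x) + u  ≡⟨ cong suc (sym (+-suc x u)) ⟩
    suc (x + suc u)  ∎
    where open ≤-Reasoning
  first-up : 0 + M C suc (suc (x + suc u)) + M C suc d ≡ M C u
  first-up rewrite k>n⇒nCk≡0 (s≤s M≤) =
    trans (nCk≡nC[n∸k] (m≤n+m (suc d) u)) (cong (M C_) (m+n∸n≡m u (suc d)))
reflection (suc u) (suc d) (suc x) (suc r) c₁ c₂ c₃ c₄ =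
  pascal-step {u + suc d} {x + suc u} {r + suc d} {u} first-down first-up
  where
  first-down : paths (suc u) d x (suc (suc r)) + (u + suc d) C suc (x + suc u) + (u + suc d) C suc (suc (r + suc d))
               ≡ (u + suc d) C suc u
  first-down rewrite +-suc u d | +-suc r d =
    reflection (suc u) d x (suc (suc r))
      (subst (λ w → suc u ≤ suc w) (sym (+-suc x (suc r))) c₁)
      (subst (λ w → d ≤ suc w) (sym (+-suc x (suc r))) (m≤n⇒m≤1+n (s≤s⁻¹ c₂)))
      (s≤s⁻¹ c₃)
      c₄
  first-up : paths u (suc d) (suc (suc x)) r + (u + suc d) C suc (suc (x + suc u)) + (u + suc d) C suc (r + suc d)
             ≡ (u + suc d) C u
  first-up rewrite +-suc x u =
    reflection u (suc d) (suc (suc x)) r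
      (m≤n⇒m≤1+n (subst (λ w → u ≤ suc w) (+-suc x r) (s≤s⁻¹ c₁)))
      (subst (λ w → suc d ≤ suc (suc w)) (+-suc x r) c₂)
      c₃
      (s≤s⁻¹ c₄)

module _ (m : ℕ) where

  walks-vanish : ∀ k {y b} → suc (k + b) < y → walks m k y b ≡ 0
  walks-vanish zero    {y} {b} b+1<y = 𝟙-no (y ≤? b + 1) (<⇒≱ (subst (_< y) (+-comm 1 b) b+1<y))
  walks-vanish (suc k) {y} {b} k+b+2<y = sumFrom-zero 0 m term-vanishes
    where
    term-vanishes : ∀ {z} → 0 ≤ z → 𝟙 (y ≤? z + 1) * walks m k z b ≡ 0
    term-vanishes {z} _ with y ≤? z + 1
    ... | no _    = refl
    ... | yes y≤z+1 = trans (+-identityʳ _) (walks-vanish k k+b+1<z)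
      where
      k+b+1<z : suc (k + b) < z
      k+b+1<z = s≤s⁻¹ (≤-trans k+b+2<y (≤-trans y≤z+1 (≤-reflexive (+-comm z 1))))

  -- A path from height y + 1 opens with some up-steps and a down-step, landing at some z ≥ y.
  tail-sum : ∀ k {b} → (∀ {u y r} → u + y ≡ suc (k + b) → y + r ≡ m → walks m k y b ≡ paths u k y r) →
             ∀ r {u y} → u + y ≡ suc (k + b) → y + suc r ≡ m →
             sumFrom y (suc r) (λ z → walks m k z b) ≡ paths u (suc k) (suc y) r
  tail-sum k walks≡ r       {zero}  {y} e₁ e₂ =
    trans (cong (walks m k y _ +_) (sumFrom-zero (suc y) r (λ y<z → walks-vanish k (subst (_< _) e₁ y<z))))
          (trans (+-identityʳ _) (walks≡ e₁ e₂))
  tail-sum k walks≡ zero    {suc u} {y} e₁ e₂ = cong (_+ 0) (walks≡ e₁ e₂)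
  tail-sum k walks≡ (suc r) {suc u} {y} e₁ e₂ =
    cong₂ _+_ (walks≡ e₁ e₂) (tail-sum k walks≡ r (trans (+-suc u y) e₁) (trans (sym (+-suc y (suc r))) e₂))

  walks≡paths : ∀ k {a b u r} → b < m → u + a ≡ suc (k + b) → a + r ≡ m → walks m k a b ≡ paths u k a r
  walks≡paths zero {a} {b} {u} {r} b<m e₁ e₂ = trans (𝟙-yes (a ≤? b + 1) a≤b+1) (sym (paths-ups u a r u≤r))
    where
    a≤b+1 : a ≤ b + 1
    a≤b+1 = ≤-trans (m≤n+m a u) (≤-reflexive (trans e₁ (+-comm 1 b)))
    u≤r : u ≤ r
    u≤r = +-cancelʳ-≤ a u r (subst₂ _≤_ (sym e₁) (trans (sym e₂) (+-comm a r)) b<m)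
  walks≡paths (suc k) {zero} {b} {zero} b<m () e₂
  walks≡paths (suc k) {zero} {b} {suc u} {zero} b<m e₁ e₂ = ⊥-elim (n≮0 (subst (b <_) (sym e₂) b<m))
  walks≡paths (suc k) {zero} {b} {suc u} {suc r} b<m e₁ e₂ = begin
    sumFrom 0 m (λ y → 𝟙 (0 ≤? y + 1) * walks m k y b)
      ≡⟨ sumFrom-cong 0 m (λ _ _ → *-identityˡ _) ⟩
    sumFrom 0 m (λ y → walks m k y b)
      ≡⟨ cong (λ c → sumFrom 0 c (λ y → walks m k y b)) (sym e₂) ⟩
    sumFrom 0 (suc r) (λ y → walks m k y b)
      ≡⟨ tail-sum k (walks≡paths k b<m) r (suc-injective e₁) e₂ ⟩
    paths u (suc k) 1 r ∎
    where open ≡-Reasoning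
  walks≡paths (suc k) {suc x} {b} {u} {r} b<m e₁ e₂ = begin
    sumFrom 0 m G
      ≡⟨ cong (λ c → sumFrom 0 c G) (sym m≡) ⟩
    sumFrom 0 (x + suc r) G
      ≡⟨ sumFrom-+ 0 x (suc r) G ⟩
    sumFrom 0 x G + sumFrom x (suc r) G
      ≡⟨ cong₂ _+_ (sumFrom-cong 0 x below) (sumFrom-cong x (suc r) above) ⟩
    sumFrom 0 x (λ _ → 0) + sumFrom x (suc r) F
      ≡⟨ cong (_+ sumFrom x (suc r) F) (trans (sumFrom-const 0 x 0) (*-zeroʳ x)) ⟩
    sumFrom x (suc r) F
      ≡⟨ tail-sum k (walks≡paths k b<m) r (suc-injective (trans (sym (+-suc u x)) e₁)) m≡ ⟩
    paths u (suc k) (suc x) r ∎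
    where
    open ≡-Reasoning
    G F : ℕ → ℕ
    G y = 𝟙 (suc x ≤? y + 1) * walks m k y b
    F y = walks m k y b
    m≡ : x + suc r ≡ m
    m≡ = trans (+-suc x r) e₂
    below : ∀ {y} → 0 ≤ y → y < x → G y ≡ 0
    below {y} _ y<x rewrite 𝟙-no (suc x ≤? y + 1) (<⇒≱ (subst (_< suc x) (+-comm 1 y) (s≤s y<x))) = refl
    above : ∀ {y} → x ≤ y → y < x + suc r → G y ≡ F y
    above {y} x≤y _ rewrite 𝟙-yes (suc x ≤? y + 1) (subst (suc x ≤_) (+-comm 1 y) (s≤s x≤y)) = *-identityˡ (F y)

binomial-sum : ∀ N → sumFrom 0 (suc N) (N C_) ≡ 2 ^ N
binomial-sum zero    = refl
binomial-sum (suc N) = begin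
  1 + sumFrom 1 (suc N) (suc N C_)
    ≡⟨ cong (1 +_) (sym (sumFrom-shift 1 0 (suc N) (suc N C_))) ⟩
  1 + sumFrom 0 (suc N) (λ j → suc N C suc j)
    ≡⟨ cong (1 +_) (sumFrom-cong 0 (suc N) (λ {j} _ _ → sym (nCk+nC[k+1]≡[n+1]C[k+1] N j))) ⟩
  1 + sumFrom 0 (suc N) (λ j → N C j + N C suc j)
    ≡⟨ cong (1 +_) (sumFrom-distrib-+ 0 (suc N) (N C_) (λ j → N C suc j)) ⟩
  1 + (S + sumFrom 0 (suc N) (λ j → N C suc j))
    ≡⟨ +-comm-left 1 S _ ⟩
  S + (1 + sumFrom 0 (suc N) (λ j → N C suc j))
    ≡⟨ cong (λ t → S + (1 + t)) (sumFrom-shift 1 0 (suc N) (N C_)) ⟩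
  S + sumFrom 0 (suc (suc N)) (N C_)
    ≡⟨ cong (S +_) (sumFrom-suc 0 (suc N) (N C_)) ⟩
  S + (S + N C suc N)
    ≡⟨ cong (λ t → S + (S + t)) (k>n⇒nCk≡0 {N} ≤-refl) ⟩
  S + (S + 0)
    ≡⟨ cong (λ t → t + (t + 0)) (binomial-sum N) ⟩
  2 ^ suc N ∎
  where
  open ≡-Reasoning
  S : ℕ
  S = sumFrom 0 (suc N) (N C_)

module ClosedForm (k : ℕ) where

  n N : ℕ
  n = suc k
  N = n + k

  closed-walk-reflection : ∀ {x} → x < n → walks n k x x + N C suc (x + n) + N C suc ((n ∸ x) + k) ≡ N C n
  closed-walk-reflection {x} x<n =
    trans (cong (λ w → w + N C suc (x + n) + N C suc ((n ∸ x) + k)) (walks≡paths n k x<n refl x+r≡n))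
          (reflection n k x (n ∸ x) n≤1+x+r k≤1+x+r k≤x+n n≤r+k)
    where
    x≤n : x ≤ n
    x≤n = <⇒≤ x<n
    x+r≡n : x + (n ∸ x) ≡ n
    x+r≡n = m+[n∸m]≡n x≤n
    n≤1+x+r : n ≤ suc (x + (n ∸ x))
    n≤1+x+r = subst (λ w → n ≤ suc w) (sym x+r≡n) (n≤1+n n)
    k≤1+x+r : k ≤ suc (x + (n ∸ x))
    k≤1+x+r = ≤-trans (n≤1+n k) n≤1+x+r
    k≤x+n : k ≤ x + n
    k≤x+n = ≤-trans (n≤1+n k) (m≤n+m n x)
    n≤r+k : n ≤ (n ∸ x) + k
    n≤r+k = begin
      n             ≡⟨ sym (m∸n+n≡m x≤n) ⟩
      (n ∸ x) + x   ≤⟨ +-monoʳ-≤ (n ∸ x) (s≤s⁻¹ x<n) ⟩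
      (n ∸ x) + k   ∎
      where open ≤-Reasoning

  ∑-bottom : sumFrom 0 n (λ x → N C suc (x + n)) ≡ sumFrom (suc n) k (N C_)
  ∑-bottom = begin
    sumFrom 0 n (λ x → N C suc (x + n))
      ≡⟨ sumFrom-cong 0 n (λ {x} _ _ → cong (λ t → N C suc t) (+-comm x n)) ⟩
    sumFrom 0 n (λ x → N C (suc n + x))
      ≡⟨ sumFrom-shift (suc n) 0 n (N C_) ⟩
    sumFrom (suc n + 0) n (N C_)
      ≡⟨ cong (λ s → sumFrom s n (N C_)) (+-identityʳ (suc n)) ⟩
    sumFrom (suc n) (suc k) (N C_)
      ≡⟨ sumFrom-suc (suc n) k (N C_) ⟩
    sumFrom (suc n) k (N C_) + N C (suc n + k)
      ≡⟨ cong (sumFrom (suc n) k (N C_) +_) (k>n⇒nCk≡0 {N} ≤-refl) ⟩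
    sumFrom (suc n) k (N C_) + 0
      ≡⟨ +-identityʳ _ ⟩
    sumFrom (suc n) k (N C_) ∎
    where open ≡-Reasoning

  ∑-top : sumFrom 0 n (λ x → N C suc ((n ∸ x) + k)) ≡ sumFrom 0 k (N C_)
  ∑-top = begin
    sumFrom 0 n T                               ≡⟨⟩
    N C suc N + sumFrom 1 k T                   ≡⟨ cong (_+ sumFrom 1 k T) (k>n⇒nCk≡0 {N} ≤-refl) ⟩
    sumFrom 1 k T                               ≡⟨ sym (sumFrom-shift 1 0 k T) ⟩
    sumFrom 0 k (λ y → N C suc ((k ∸ y) + k))   ≡⟨ sumFrom-cong 0 k (λ _ y<k → mirror (<⇒≤ y<k)) ⟩
    sumFrom 0 k (N C_)                          ∎
    where
    open ≡-Reasoning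
    T : ℕ → ℕ
    T x = N C suc ((n ∸ x) + k)
    mirror : ∀ {y} → y ≤ k → N C suc ((k ∸ y) + k) ≡ N C y
    mirror {y} y≤k = sym (begin
      N C y                 ≡⟨ nCk≡nC[n∸k] (≤-trans y≤k (m≤n+m k n)) ⟩
      N C (N ∸ y)           ≡⟨ cong (N C_) (+-∸-comm k (m≤n⇒m≤1+n y≤k)) ⟩
      N C ((n ∸ y) + k)     ≡⟨ cong (λ t → N C (t + k)) (+-∸-assoc 1 y≤k) ⟩
      N C suc ((k ∸ y) + k) ∎)

  2^N-split : 2 ^ N ≡ sumFrom 0 k (N C_) + (N C k + (N C n + sumFrom (suc n) k (N C_)))
  2^N-split = begin
    2 ^ N                                 ≡⟨ sym (binomial-sum N) ⟩
    sumFrom 0 (suc N) (N C_)              ≡⟨ cong (λ c → sumFrom 0 c (N C_)) 1+N≡ ⟩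
    sumFrom 0 (k + suc n) (N C_)          ≡⟨ sumFrom-+ 0 k (suc n) (N C_) ⟩
    sumFrom 0 k (N C_) + (N C k + (N C n + sumFrom (suc n) k (N C_))) ∎
    where
    open ≡-Reasoning
    1+N≡ : suc N ≡ k + suc n
    1+N≡ = sym (trans (+-suc k n) (cong suc (+-suc k k)))

  C-sym : N C k ≡ N C n
  C-sym = trans (nCk≡nC[n∸k] (m≤n+m k n)) (cong (N C_) (m+n∸n≡m n k))

  ∑-closed-walks : sumFrom 0 n (λ x → walks n k x x) + sumFrom (suc n) k (N C_) + sumFrom 0 k (N C_) ≡ n * (N C n)
  ∑-closed-walks = begin
    sumFrom 0 n w + sumFrom (suc n) k (N C_) + sumFrom 0 k (N C_)
      ≡⟨ cong₂ (λ s s′ → sumFrom 0 n w + s + s′) (sym ∑-bottom) (sym ∑-top) ⟩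
    sumFrom 0 n w + sumFrom 0 n bottom + sumFrom 0 n top
      ≡⟨ cong (_+ sumFrom 0 n top) (sym (sumFrom-distrib-+ 0 n w bottom)) ⟩
    sumFrom 0 n (λ x → w x + bottom x) + sumFrom 0 n top
      ≡⟨ sym (sumFrom-distrib-+ 0 n (λ x → w x + bottom x) top) ⟩
    sumFrom 0 n (λ x → w x + bottom x + top x)
      ≡⟨ sumFrom-cong 0 n (λ _ x<n → closed-walk-reflection x<n) ⟩
    sumFrom 0 n (λ _ → N C n)
      ≡⟨ sumFrom-const 0 n (N C n) ⟩
    n * (N C n) ∎
    where
    open ≡-Reasoning
    w bottom top : ℕ → ℕ
    w x = walks n k x x
    bottom x = N C suc (x + n)
    top x = N C suc ((n ∸ x) + k)

  g-closed-form : g n + 2 ^ N ≡ (n + 2) * (N C k)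
  g-closed-form = begin
    g n + 2 ^ N                        ≡⟨ cong₂ _+_ (g≡∑closedWalks k) 2^N-split ⟩
    W + (A + (N C k + (N C n + B)))    ≡⟨ regroup W A B (N C k) (N C n) ⟩
    (W + B + A) + (N C n + N C k)      ≡⟨ cong₂ (λ s c → s + (c + N C k)) ∑-closed-walks (sym C-sym) ⟩
    n * (N C n) + (N C k + N C k)      ≡⟨ cong (λ c → n * c + (N C k + N C k)) (sym C-sym) ⟩
    n * (N C k) + (N C k + N C k)      ≡⟨ distribute n (N C k) ⟩
    (n + 2) * (N C k)                  ∎
    where
    open ≡-Reasoning
    W A B : ℕ
    W = sumFrom 0 n (λ x → walks n k x x)
    A = sumFrom 0 k (N C_)
    B = sumFrom (suc n) k (N C_)
    regroup : ∀ w a b c c′ → w + (a + (c + (c′ + b))) ≡ (w + b + a) + (c′ + c)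
    regroup = solve-∀
    distribute : ∀ m c → m * c + (c + c) ≡ (m + 2) * c
    distribute = solve-∀

mainTheorem1 : (n : ℕ) → 1 ≤ n →
    g n + 2 ^ (2 * n ∸ 1) ≡ (n + 2) * ((2 * n ∸ 1) C (n ∸ 1))
mainTheorem1 (suc k) _ = subst (λ N → g (suc k) + 2 ^ N ≡ (suc k + 2) * (N C k)) N≡2n∸1 (ClosedForm.g-closed-form k)
  where
  N≡2n∸1 : suc k + k ≡ 2 * suc k ∸ 1
  N≡2n∸1 = sym (trans (+-suc k (k + 0)) (cong (λ t → suc (k + t)) (+-identityʳ k)))
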